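{- Let $N=\{1,\ldots,n\}$, let $w:2^N\to\mathbb R$ be a set function with $w(\emptyset)=0$, and let $W:\Delta_N\to\mathbb R$ be the global worth function defined in the context. Then there exists a partition $P$ of $N$ whose associated fuzzy cover $\mathbf p$ satisfies $W(\mathbf p)\ge W(\mathbf q)$ for all $\mathbf q\in\Delta_N$, and moreover $W(\mathbf p)=\sum_{A\in P}w(A)$.
   Context: For $i\in N$ let $2^N_i=\{A\subseteq N: i\in A\}$ and let $\Delta_i=\{q_i=(q_i^A)_{A\in 2^N_i}\in\mathbb R_+^{2^N_i}:\sum_{A\in 2^N_i}q_i^A=1\}$. Fuzzy covers are elements $\mathbf q=(q_1,\ldots,q_n)\in\Delta_N=\times_{i\in N}\Delta_i$, with the convention $q_i^A=0$ whenever $i\notin A$. The Möbius inversion of $w$ is $\mu^w(A)=\sum_{B\subseteq A}(-1)^{|A\setminus B|}w(B)$, and the global worth is $W(\mathbf q)=\sum_{A\in 2^N}\sum_{B\subseteq A}\left(\prod_{i\in B}q_i^A\right)\mu^w(B)$ (empty product $=1$). A partition $P$ of $N$ (a family of pairwise disjoint nonempty blocks with union $N$) has associated fuzzy cover $\mathbf p\in\Delta_N$ defined by $p_i^A=1$ if $A\in P$ and $i\in A$, and $p_i^A=0$ otherwise. -}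

module Defs where

open import Level using (Level; _⊔_) renaming (suc to lsuc)
open import Algebra.Bundles using (CommutativeRing)
open import Relation.Binary.Structures using (IsTotalOrder)
open import Data.Nat using (ℕ; zero; suc)
open import Data.Bool using (Bool; true; false; if_then_else_)
import Data.Bool as Bool
open import Data.Fin using (Fin)
open import Data.Fin.Subset using (Subset; _∈_; _∉_; _⊆_; _─_; ∣_∣; Nonempty; _∩_; inside; outside; ⊥)
open import Data.Fin.Subset.Properties using (_∈?_; _⊆?_)
open import Data.Vec using ([]; _∷_)
open import Data.Vec.Properties using (≡-dec)
open import Data.List using (List; []; _∷_; _++_; map; foldr; filter)
open import Data.List.Base using (allFin)
open import Data.List.Relation.Unary.All using (All)
open import Data.List.Relation.Unary.Any using (Any; any?)
open import Data.List.Relation.Unary.AllPairs using (AllPairs)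
open import Data.Product using (_×_)
open import Relation.Nullary using (¬_; does)
open import Relation.Binary.PropositionalEquality using (_≡_)

-- An ordered commutative ring (the reals are an instance): a commutative
-- ring with a total order compatible with + and with * on nonnegatives.
record OrderedCommRing (c ℓ₁ ℓ₂ : Level) : Set (lsuc (c ⊔ ℓ₁ ⊔ ℓ₂)) where
  field
    commutativeRing : CommutativeRing c ℓ₁
  open CommutativeRing commutativeRing public
  infix 4 _≤_
  field
    _≤_ : Carrier → Carrier → Set ℓ₂
    isTotalOrder : IsTotalOrder _≈_ _≤_
    +-mono-≤ : ∀ {x y} z → x ≤ y → (x + z) ≤ (y + z)
    *-nonneg : ∀ {x y} → 0# ≤ x → 0# ≤ y → 0# ≤ (x * y)

allSubsets : (n : ℕ) → List (Subset n)
allSubsets zero = [] ∷ []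
allSubsets (suc n) = map (inside ∷_) (allSubsets n) ++ map (outside ∷_) (allSubsets n)

_≟ₛ_ : ∀ {n} (A B : Subset n) → Relation.Nullary.Dec (A ≡ B)
_≟ₛ_ = ≡-dec Bool._≟_

module _ {c ℓ₁ ℓ₂ : Level} (R : OrderedCommRing c ℓ₁ ℓ₂) where
  open OrderedCommRing R

  Σl : List Carrier → Carrier
  Σl = foldr _+_ 0#

  Πl : List Carrier → Carrier
  Πl = foldr _*_ 1#

  negOnePow : ℕ → Carrier
  negOnePow zero = 1#
  negOnePow (suc k) = - negOnePow k

  subsetsOf : ∀ {n} → Subset n → List (Subset n)
  subsetsOf {n} A = filter (λ B → B ⊆? A) (allSubsets n)

  mobius : ∀ {n} → (Subset n → Carrier) → Subset n → Carrier
  mobius w A = Σl (map (λ B → negOnePow ∣ A ─ B ∣ * w B) (subsetsOf A))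

  prodOver : ∀ {n} → Subset n → (Fin n → Carrier) → Carrier
  prodOver {n} B f = Πl (map f (filter (λ i → i ∈? B) (allFin n)))

  -- Fuzzy covers: q i A = q_i^A, with q_i^A = 0 when i ∉ A.
  FuzzyCover : ℕ → Set c
  FuzzyCover n = Fin n → Subset n → Carrier

  IsFuzzyCover : ∀ {n} → FuzzyCover n → Set (ℓ₁ ⊔ ℓ₂)
  IsFuzzyCover {n} q =
    (∀ i A → 0# ≤ q i A) ×
    (∀ i A → i ∉ A → q i A ≈ 0#) ×
    (∀ i → Σl (map (q i) (filter (λ A → i ∈? A) (allSubsets n))) ≈ 1#)

  globalWorth : ∀ {n} → (Subset n → Carrier) → FuzzyCover n → Carrier
  globalWorth {n} w q =
    Σl (map (λ A → Σl (map (λ B → prodOver B (λ i → q i A) * mobius w B) (subsetsOf A)))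
            (allSubsets n))

  partitionCover : ∀ {n} → List (Subset n) → FuzzyCover n
  partitionCover P i A =
    if does (any? (λ B → A ≟ₛ B) P) Bool.∧ does (i ∈? A) then 1# else 0#

  sumOverBlocks : ∀ {n} → (Subset n → Carrier) → List (Subset n) → Carrier
  sumOverBlocks w P = Σl (map w P)

IsPartition : ∀ {n} → List (Subset n) → Set
IsPartition {n} P =
  All Nonempty P ×
  AllPairs (λ A B → ¬ Nonempty (A ∩ B)) P ×
  (∀ (i : Fin n) → Any (i ∈_) P)

-- W is multilinear: W(q) = Σ_A f_A(q^A), where f_A(x) = Σ_{B ⊆ A} μ^w(B) Π_{i ∈ B} x_i, and Möbius
-- inversion gives f_A(1_T) = w(A ∩ T). In particular W is affine in each row q_i, which is a
-- probability vector on the coalitions containing i, so replacing q_i by the point mass at a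
-- coalition of maximal slope does not decrease W. Doing this row by row moves any fuzzy cover to a
-- vertex, where every player i has picked one coalition ch(i) ∋ i; there W equals
-- Σ_A w(A ∩ {i | ch(i) = A}), the value of the partition into the nonempty fibres of ch. A best
-- choice function among the finitely many ones gives a partition that works for every q.

module Submission where

open import Defs
open import Level using (Level; _⊔_)
open import Data.Nat using (ℕ; zero; suc)
open import Data.Bool using (Bool; true; false; if_then_else_; _∧_)
open import Data.Fin using (Fin) renaming (_≟_ to _≟ᶠ_)
open import Data.Fin.Properties using (all?)
open import Data.Fin.Subset using (Subset; inside; outside; _∩_; ⊤; ⊥; Nonempty)
  renaming (_∈_ to _∈ₛ_; _∉_ to _∉ₛ_)
open import Data.Fin.Subset.Properties
  using (_∈?_; _⊆?_; ∈⊤; ∉⊥; nonempty?; Empty-unique; ∩-idem; ∩-zeroʳ; x∈p∩q⁺; p∩q⊆p; p∩q⊆q)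
open import Data.Vec using ([]; _∷_; tabulate)
open import Data.Vec.Properties using (lookup∘tabulate; []=⇒lookup; lookup⇒[]=)
import Data.Vec.Functional as Vector
open import Data.Vec.Functional using (updateAt)
open import Data.Vec.Functional.Properties using (updateAt-updates; updateAt-minimal; updateAt-id-local; map-updateAt)
open import Data.List using (List; []; _∷_; _++_; map; filter; allFin; cartesianProductWith)
open import Data.List.Properties using (map-∘; map-cong; map-cong-local; filter-++)
open import Data.List.Membership.Propositional using (_∈_)
open import Data.List.Membership.Propositional.Properties
  using (∈-map⁺; ∈-map⁻; ∈-++⁺ˡ; ∈-++⁺ʳ; ∈-filter⁺; ∈-filter⁻; ∈-allFin; ∈-cartesianProductWith⁺)
open import Data.List.Relation.Unary.Any as Any using (Any; here; there; any?)
open import Data.List.Relation.Unary.All as All using (All; []; _∷_)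
open import Data.List.Relation.Unary.Unique.Propositional using (Unique)
open import Data.List.Relation.Unary.AllPairs as AllPairs using (AllPairs; []; _∷_)
import Data.List.Relation.Unary.AllPairs.Properties as AllPairs
open import Data.List.Relation.Unary.All.Properties using (all-filter)
import Data.List.Relation.Unary.Unique.Propositional.Properties as Unique
open import Data.Product using (Σ; Σ-syntax; _×_; _,_; proj₁; proj₂)
open import Data.Empty using (⊥-elim)
open import Data.Sum using (inj₁; inj₂)
open import Function using (_∘_; _∋_; _$_; const)
open import Relation.Nullary using (¬_; Dec; yes; no; does)
open import Relation.Unary using (Decidable)
open import Relation.Nullary.Decidable using (dec-true)
open import Relation.Binary.Definitions using (DecidableEquality)
open import Relation.Binary.PropositionalEquality as ≡ using (_≡_; _≢_; _≗_)
open import Relation.Binary.Bundles using (Poset; TotalOrder)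
open import Relation.Binary.Structures using (IsTotalOrder)
import Relation.Binary.Reasoning.PartialOrder
import Data.List.Extrema as Extrema

∈-allSubsets : ∀ {n} (A : Subset n) → A ∈ allSubsets n
∈-allSubsets [] = here ≡.refl
∈-allSubsets (inside ∷ A) = ∈-++⁺ˡ (∈-map⁺ (inside ∷_) (∈-allSubsets A))
∈-allSubsets {suc n} (outside ∷ A) =
  ∈-++⁺ʳ (map (inside ∷_) (allSubsets n)) (∈-map⁺ (outside ∷_) (∈-allSubsets A))

allSubsets-unique : ∀ n → Unique (allSubsets n)
allSubsets-unique zero = [] ∷ []
allSubsets-unique (suc n) =
  Unique.++⁺ (Unique.map⁺ ∷-injectiveʳ (allSubsets-unique n))
             (Unique.map⁺ ∷-injectiveʳ (allSubsets-unique n)) disjoint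
  where
  ∷-injectiveʳ : ∀ {b : Bool} {A B : Subset n} → (Subset (suc n) ∋ b ∷ A) ≡ b ∷ B → A ≡ B
  ∷-injectiveʳ ≡.refl = ≡.refl
  disjoint : ∀ {A} → ¬ (A ∈ map (inside ∷_) (allSubsets n) × A ∈ map (outside ∷_) (allSubsets n))
  disjoint (A∈ᵢ , A∈ₒ) with ∈-map⁻ (inside ∷_) A∈ᵢ | ∈-map⁻ (outside ∷_) A∈ₒ
  ... | _ , _ , ≡.refl | _ , _ , ()

allFunctions : ∀ {a} {A : Set a} → List A → (m : ℕ) → List (Fin m → A)
allFunctions xs zero = Vector.[] ∷ []
allFunctions xs (suc m) = cartesianProductWith Vector._∷_ xs (allFunctions xs m)

allFunctions-complete : ∀ {a} {A : Set a} (xs : List A) m (f : Fin m → A) → (∀ i → f i ∈ xs) →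
  Σ[ g ∈ (Fin m → A) ] g ∈ allFunctions xs m × g ≗ f
allFunctions-complete xs zero f _ = Vector.[] , here ≡.refl , λ ()
allFunctions-complete xs (suc m) f f∈ with allFunctions-complete xs m (f ∘ Fin.suc) (f∈ ∘ Fin.suc)
... | g , g∈ , g≗f = f Fin.zero Vector.∷ g , ∈-cartesianProductWith⁺ Vector._∷_ (f∈ Fin.zero) g∈ ,
  λ { Fin.zero → ≡.refl ; (Fin.suc i) → g≗f i }

IsChoice : ∀ {n} → (Fin n → Subset n) → Set
IsChoice ch = ∀ i → i ∈ₛ ch i

isChoice? : ∀ {n} (ch : Fin n → Subset n) → Dec (IsChoice ch)
isChoice? ch = all? (λ i → i ∈? ch i)

fibre : ∀ {n} → (Fin n → Subset n) → Subset n → Subset n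
fibre ch A = tabulate (λ i → does (A ≟ₛ ch i))

block : ∀ {n} → (Fin n → Subset n) → Subset n → Subset n
block ch A = A ∩ fibre ch A

blocks : ∀ {n} → (Fin n → Subset n) → List (Subset n)
blocks {n} ch = filter nonempty? (map (block ch) (allSubsets n))

∈-fibre⁻ : ∀ {n} (ch : Fin n → Subset n) {A i} → i ∈ₛ fibre ch A → A ≡ ch i
∈-fibre⁻ ch {A} {i} i∈
  with A ≟ₛ ch i | ≡.trans (≡.sym (lookup∘tabulate (λ k → does (A ≟ₛ ch k)) i)) ([]=⇒lookup i∈)
... | yes A≡ch[i] | _ = A≡ch[i]
... | no _        | ()

∈-fibre⁺ : ∀ {n} (ch : Fin n → Subset n) i → i ∈ₛ fibre ch (ch i)
∈-fibre⁺ ch i = lookup⇒[]= i (fibre ch (ch i))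
  (≡.trans (lookup∘tabulate (λ k → does (ch i ≟ₛ ch k)) i) (dec-true (ch i ≟ₛ ch i) ≡.refl))

blocks-partition : ∀ {n} {ch : Fin n → Subset n} → IsChoice ch → IsPartition (blocks ch)
blocks-partition {n} {ch} i∈ch[i] =
  all-filter nonempty? (map (block ch) (allSubsets n)) ,
  AllPairs.filter⁺ nonempty? (AllPairs.map⁺ (AllPairs.map disjoint (allSubsets-unique n))) ,
  covers
  where
  disjoint : ∀ {A B} → A ≢ B → ¬ Nonempty (block ch A ∩ block ch B)
  disjoint {A} {B} A≢B (i , i∈) = A≢B (≡.trans (∈-fibre⁻ ch (p∩q⊆q _ _ (p∩q⊆p _ _ i∈)))
                                               (≡.sym (∈-fibre⁻ ch (p∩q⊆q _ _ (p∩q⊆q _ _ i∈)))))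
  covers : ∀ i → Any (i ∈ₛ_) (blocks ch)
  covers i = Any.map (λ { ≡.refl → i∈block })
    (∈-filter⁺ nonempty? (∈-map⁺ (block ch) (∈-allSubsets (ch i))) (i , i∈block))
    where
    i∈block : i ∈ₛ block ch (ch i)
    i∈block = x∈p∩q⁺ (i∈ch[i] i , ∈-fibre⁺ ch i)

disjoint-nonempty⇒unique : ∀ {n} {P : List (Subset n)} → All Nonempty P →
  AllPairs (λ A B → ¬ Nonempty (A ∩ B)) P → Unique P
disjoint-nonempty⇒unique [] [] = []
disjoint-nonempty⇒unique {P = A ∷ _} (A≠∅ ∷ P≠∅) (A-disjoint ∷ P-disjoint) =
  All.map (λ A∩B=∅ A≡B → A∩B=∅ (≡.subst (λ B → Nonempty (A ∩ B)) A≡B A∩A≠∅)) A-disjoint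
  ∷ disjoint-nonempty⇒unique P≠∅ P-disjoint
  where
  A∩A≠∅ : Nonempty (A ∩ A)
  A∩A≠∅ = ≡.subst Nonempty (≡.sym (∩-idem A)) A≠∅

module _ {c ℓ₁ ℓ₂ : Level} (R : OrderedCommRing c ℓ₁ ℓ₂) where
  open OrderedCommRing R
  open IsTotalOrder isTotalOrder using (total)
    renaming (refl to ≤-refl; trans to ≤-trans; reflexive to ≤-reflexive)

  poset : Poset c ℓ₁ ℓ₂
  poset = record { isPartialOrder = IsTotalOrder.isPartialOrder isTotalOrder }

  module ≤-Reasoning = Relation.Binary.Reasoning.PartialOrder poset

  totalOrder : TotalOrder c ℓ₁ ℓ₂
  totalOrder = record { isTotalOrder = isTotalOrder }

  +-mono₂-≤ : ∀ {x y u v} → x ≤ y → u ≤ v → x + u ≤ y + v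
  +-mono₂-≤ {x} {y} {u} {v} x≤y u≤v = ≤-trans (+-mono-≤ u x≤y) (begin
    y + u ≈⟨ +-comm y u ⟩
    u + y ≤⟨ +-mono-≤ y u≤v ⟩
    v + y ≈⟨ +-comm v y ⟩
    y + v ∎)
    where open ≤-Reasoning

  *-monoˡ-≤-nonneg : ∀ {a x y} → 0# ≤ a → x ≤ y → a * x ≤ a * y
  *-monoˡ-≤-nonneg {a} {x} {y} 0≤a x≤y = begin
    a * x                 ≈⟨ +-identityˡ (a * x) ⟨
    0# + a * x            ≤⟨ +-mono-≤ (a * x) (*-nonneg 0≤a 0≤y-x) ⟩
    a * (y - x) + a * x   ≈⟨ distribˡ a (y - x) x ⟨
    a * ((y - x) + x)     ≈⟨ *-congˡ (+-assoc y (- x) x) ⟩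
    a * (y + (- x + x))   ≈⟨ *-congˡ (+-congˡ (-‿inverseˡ x)) ⟩
    a * (y + 0#)          ≈⟨ *-congˡ (+-identityʳ y) ⟩
    a * y                 ∎
    where
    open ≤-Reasoning
    0≤y-x : 0# ≤ y - x
    0≤y-x = begin
      0#     ≈⟨ -‿inverseʳ x ⟨
      x - x  ≤⟨ +-mono-≤ (- x) x≤y ⟩
      y - x  ∎

  x*x-nonneg : ∀ x → 0# ≤ x * x
  x*x-nonneg x with total 0# x
  ... | inj₁ 0≤x = *-nonneg 0≤x 0≤x
  ... | inj₂ x≤0 = ≤-trans (*-nonneg 0≤-x 0≤-x) (≤-reflexive (-x*-x≈x*x))
    where
    open import Algebra.Properties.Ring ring using (-‿distribˡ-*; -‿distribʳ-*)
    0≤-x : 0# ≤ - x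
    0≤-x = begin
      0#      ≈⟨ -‿inverseʳ x ⟨
      x - x   ≤⟨ +-mono-≤ (- x) x≤0 ⟩
      0# - x  ≈⟨ +-identityˡ (- x) ⟩
      - x     ∎
      where open ≤-Reasoning
    -x*-x≈x*x : - x * - x ≈ x * x
    -x*-x≈x*x = trans (sym (-‿distribˡ-* x (- x)))
      (trans (-‿cong (sym (-‿distribʳ-* x x))) (-‿involutive (x * x)))
      where open import Algebra.Properties.Group +-group using () renaming (⁻¹-involutive to -‿involutive)

  0≤1 : 0# ≤ 1#
  0≤1 = ≤-trans (x*x-nonneg 1#) (≤-reflexive (*-identityˡ 1#))

  ∑ : ∀ {a} {X : Set a} → (X → Carrier) → List X → Carrier
  ∑ f xs = Σl R (map f xs)

  syntax ∑ (λ x → e) xs = ∑[ x ← xs ] e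

  module _ {a} {X : Set a} where

    ∑-cong : ∀ {f g : X → Carrier} → (∀ x → f x ≈ g x) → ∀ xs → ∑ f xs ≈ ∑ g xs
    ∑-cong f≈g [] = refl
    ∑-cong f≈g (x ∷ xs) = +-cong (f≈g x) (∑-cong f≈g xs)

    ∑-zero : ∀ {f : X → Carrier} xs → (∀ {x} → x ∈ xs → f x ≈ 0#) → ∑ f xs ≈ 0#
    ∑-zero [] _ = refl
    ∑-zero (x ∷ xs) f≈0 = trans (+-cong (f≈0 (here ≡.refl)) (∑-zero xs (f≈0 ∘ there))) (+-identityˡ 0#)

    ∑-mono : ∀ {f g : X → Carrier} xs → (∀ {x} → x ∈ xs → f x ≤ g x) → ∑ f xs ≤ ∑ g xs
    ∑-mono [] _ = ≤-refl
    ∑-mono (x ∷ xs) f≤g = +-mono₂-≤ (f≤g (here ≡.refl)) (∑-mono xs (f≤g ∘ there))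

    ∑-+ : ∀ (f g : X → Carrier) xs → ∑[ x ← xs ] (f x + g x) ≈ ∑ f xs + ∑ g xs
    ∑-+ f g [] = sym (+-identityˡ 0#)
    ∑-+ f g (x ∷ xs) = trans (+-congˡ (∑-+ f g xs)) (interchange (f x) (g x) (∑ f xs) (∑ g xs))
      where open import Algebra.Properties.CommutativeSemigroup +-commutativeSemigroup using (interchange)

    ∑-*ˡ : ∀ a (f : X → Carrier) xs → ∑[ x ← xs ] (a * f x) ≈ a * ∑ f xs
    ∑-*ˡ a f [] = sym (zeroʳ a)
    ∑-*ˡ a f (x ∷ xs) = trans (+-congˡ (∑-*ˡ a f xs)) (sym (distribˡ a (f x) (∑ f xs)))

    ∑-neg : ∀ (f : X → Carrier) xs → ∑[ x ← xs ] (- f x) ≈ - ∑ f xs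
    ∑-neg f [] = sym ε⁻¹≈ε
      where open import Algebra.Properties.Group +-group using (ε⁻¹≈ε)
    ∑-neg f (x ∷ xs) = trans (+-congˡ (∑-neg f xs)) (⁻¹-∙-comm (f x) (∑ f xs))
      where open import Algebra.Properties.AbelianGroup +-abelianGroup using (⁻¹-∙-comm)

    ∑-++ : ∀ (f : X → Carrier) xs ys → ∑ f (xs ++ ys) ≈ ∑ f xs + ∑ f ys
    ∑-++ f [] ys = sym (+-identityˡ (∑ f ys))
    ∑-++ f (x ∷ xs) ys = trans (+-congˡ (∑-++ f xs ys)) (sym (+-assoc (f x) (∑ f xs) (∑ f ys)))

    ∑-map : ∀ {b} {Y : Set b} (f : Y → Carrier) (g : X → Y) xs → ∑ f (map g xs) ≡ ∑ (f ∘ g) xs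
    ∑-map f g xs = ≡.cong (Σl R) (≡.sym (map-∘ xs))

    ∑-filter : ∀ {p} {P : X → Set p} (P? : Decidable P) (f : X → Carrier) xs →
      ∑ f (filter P? xs) ≈ ∑[ x ← xs ] (if does (P? x) then f x else 0#)
    ∑-filter P? f [] = refl
    ∑-filter P? f (x ∷ xs) with does (P? x)
    ... | true  = +-congˡ (∑-filter P? f xs)
    ... | false = trans (∑-filter P? f xs) (sym (+-identityˡ _))

    ∑-filter-support : ∀ {p} {P : X → Set p} (P? : Decidable P) {f : X → Carrier} xs →
      (∀ x → ¬ P x → f x ≈ 0#) → ∑ f (filter P? xs) ≈ ∑ f xs
    ∑-filter-support P? {f} xs f≈0 = trans (∑-filter P? f xs) (∑-cong restrict xs)
      where
      restrict : ∀ x → (if does (P? x) then f x else 0#) ≈ f x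
      restrict x with P? x
      ... | yes _  = refl
      ... | no ¬Px = sym (f≈0 x ¬Px)

    module _ (_≟_ : DecidableEquality X) where

      ∑-indicator : ∀ (f : X → Carrier) {y} xs → Unique xs → y ∈ xs →
        ∑[ x ← xs ] (if does (x ≟ y) then f x else 0#) ≈ f y
      ∑-indicator f {y} (x ∷ xs) (x∉xs ∷ xs!) y∈ with x ≟ y | y∈
      ... | yes ≡.refl | _ = trans (+-congˡ (∑-zero xs vanish)) (+-identityʳ (f x))
        where
        vanish : ∀ {z} → z ∈ xs → (if does (z ≟ x) then f z else 0#) ≈ 0#
        vanish {z} z∈ with z ≟ x
        ... | yes ≡.refl = ⊥-elim (All.lookup x∉xs z∈ ≡.refl)
        ... | no _       = refl
      ... | no x≢y | here y≡x  = ⊥-elim (x≢y (≡.sym y≡x))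
      ... | no _   | there y∈xs = trans (+-identityˡ _) (∑-indicator f xs xs! y∈xs)

      ∑-indicator-list : ∀ (f : X → Carrier) {xs} ys → Unique xs → Unique ys →
        (∀ {y} → y ∈ ys → y ∈ xs) →
        ∑[ x ← xs ] (if does (any? (x ≟_) ys) then f x else 0#) ≈ ∑ f ys
      ∑-indicator-list f {xs} [] _ _ _ = ∑-zero xs (λ _ → refl)
      ∑-indicator-list f {xs} (y ∷ ys) xs! (y∉ys ∷ ys!) ys⊆xs = begin
        ∑[ x ← xs ] (if does (any? (x ≟_) (y ∷ ys)) then f x else 0#)
          ≈⟨ ∑-cong split xs ⟩
        ∑[ x ← xs ] ((if does (x ≟ y) then f x else 0#) + (if does (any? (x ≟_) ys) then f x else 0#))
          ≈⟨ ∑-+ _ _ xs ⟩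
        ∑[ x ← xs ] (if does (x ≟ y) then f x else 0#) + ∑[ x ← xs ] (if does (any? (x ≟_) ys) then f x else 0#)
          ≈⟨ +-cong (∑-indicator f xs xs! (ys⊆xs (here ≡.refl)))
                    (∑-indicator-list f ys xs! ys! (ys⊆xs ∘ there)) ⟩
        f y + ∑ f ys ∎
        where
        open import Relation.Binary.Reasoning.Setoid setoid
        split : ∀ x → (if does (any? (x ≟_) (y ∷ ys)) then f x else 0#) ≈
          (if does (x ≟ y) then f x else 0#) + (if does (any? (x ≟_) ys) then f x else 0#)
        split x with x ≟ y | any? (x ≟_) ys
        ... | yes ≡.refl | yes x∈ys = ⊥-elim (All.lookup y∉ys x∈ys ≡.refl)
        ... | yes _      | no _     = sym (+-identityʳ (f x))
        ... | no _       | yes _    = sym (+-identityˡ (f x))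
        ... | no _       | no _     = sym (+-identityˡ 0#)

    ∑-convex-≤ : ∀ {v f : X → Carrier} {M} xs → (∀ {x} → x ∈ xs → 0# ≤ v x) → ∑ v xs ≈ 1# →
      (∀ {x} → x ∈ xs → f x ≤ M) → ∑[ x ← xs ] (v x * f x) ≤ M
    ∑-convex-≤ {v} {f} {M} xs v≥0 ∑v≈1 f≤M = begin
      ∑[ x ← xs ] (v x * f x) ≤⟨ ∑-mono xs (λ x∈ → *-monoˡ-≤-nonneg (v≥0 x∈) (f≤M x∈)) ⟩
      ∑[ x ← xs ] (v x * M)   ≈⟨ ∑-cong (λ x → *-comm (v x) M) xs ⟩
      ∑[ x ← xs ] (M * v x)   ≈⟨ ∑-*ˡ M v xs ⟩
      M * ∑ v xs              ≈⟨ *-congˡ ∑v≈1 ⟩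
      M * 1#                  ≈⟨ *-identityʳ M ⟩
      M                       ∎
      where open ≤-Reasoning

  record Affine (f : Carrier → Carrier) : Set (c ⊔ ℓ₁) where
    field
      intercept slope : Carrier
      eval : ∀ a → f a ≈ intercept + a * slope

  module _ where
    open Affine
    open import Algebra.Solver.Ring.NaturalCoefficients.Default commutativeSemiring

    Affine-resp : ∀ {f g} → (∀ a → f a ≈ g a) → Affine g → Affine f
    Affine-resp f≈g g-affine = record
      { intercept = intercept g-affine ; slope = slope g-affine
      ; eval = λ a → trans (f≈g a) (eval g-affine a) }

    Affine-const : ∀ b → Affine (λ _ → b)
    Affine-const b = record
      { intercept = b ; slope = 0#
      ; eval = solve 2 (λ b a → b := b :+ a :* con 0) refl b }

    Affine-linear : ∀ d → Affine (λ a → a * d)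
    Affine-linear d = record
      { intercept = 0# ; slope = d
      ; eval = λ a → solve 2 (λ a d → a :* d := con 0 :+ a :* d) refl a d }

    Affine-*ˡ : ∀ k {f} → Affine f → Affine (λ a → k * f a)
    Affine-*ˡ k f-affine = record
      { intercept = k * intercept f-affine ; slope = k * slope f-affine
      ; eval = λ a → trans (*-congˡ (eval f-affine a))
          (solve 4 (λ k b a d → k :* (b :+ a :* d) := k :* b :+ a :* (k :* d)) refl
            k (intercept f-affine) a (slope f-affine)) }

    Affine-*ʳ : ∀ k {f} → Affine f → Affine (λ a → f a * k)
    Affine-*ʳ k f-affine = Affine-resp (λ a → *-comm _ k) (Affine-*ˡ k f-affine)

    Affine-∑ : ∀ {a} {X : Set a} {f : X → Carrier → Carrier} xs →
      (∀ x → Affine (f x)) → Affine (λ a → ∑[ x ← xs ] f x a)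
    Affine-∑ [] _ = Affine-const 0#
    Affine-∑ {f = f} (x ∷ xs) f-affine = record
      { intercept = intercept fx + intercept rest ; slope = slope fx + slope rest
      ; eval = λ a → trans (+-cong (eval fx a) (eval rest a))
          (solve 5 (λ b d b′ d′ a → (b :+ a :* d) :+ (b′ :+ a :* d′) := (b :+ b′) :+ a :* (d :+ d′)) refl
            (intercept fx) (slope fx) (intercept rest) (slope rest) a) }
      where
      fx = f-affine x
      rest = Affine-∑ xs f-affine

  module _ {n : ℕ} where

    filter-⊆?-map-outside : ∀ y (X : Subset n) xs →
      filter (_⊆? (y ∷ X)) (map (outside ∷_) xs) ≡ map (outside ∷_) (filter (_⊆? X) xs)
    filter-⊆?-map-outside y X [] = ≡.refl
    filter-⊆?-map-outside y X (B ∷ xs) with does (B ⊆? X)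
    ... | true  = ≡.cong ((outside ∷ B) ∷_) (filter-⊆?-map-outside y X xs)
    ... | false = filter-⊆?-map-outside y X xs

    filter-⊆?-map-inside : ∀ (X : Subset n) xs →
      filter (_⊆? (inside ∷ X)) (map (inside ∷_) xs) ≡ map (inside ∷_) (filter (_⊆? X) xs)
    filter-⊆?-map-inside X [] = ≡.refl
    filter-⊆?-map-inside X (B ∷ xs) with does (B ⊆? X)
    ... | true  = ≡.cong ((inside ∷ B) ∷_) (filter-⊆?-map-inside X xs)
    ... | false = filter-⊆?-map-inside X xs

    filter-⊆?-outside-map-inside : ∀ (X : Subset n) xs → filter (_⊆? (outside ∷ X)) (map (inside ∷_) xs) ≡ []
    filter-⊆?-outside-map-inside X [] = ≡.refl
    filter-⊆?-outside-map-inside X (B ∷ xs) = filter-⊆?-outside-map-inside X xs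

    subsetsOf-outside : ∀ (X : Subset n) → subsetsOf R (outside ∷ X) ≡ map (outside ∷_) (subsetsOf R X)
    subsetsOf-outside X = ≡.trans (filter-++ (_⊆? (outside ∷ X)) (map (inside ∷_) all) (map (outside ∷_) all))
      (≡.cong₂ _++_ (filter-⊆?-outside-map-inside X all) (filter-⊆?-map-outside outside X all))
      where all = allSubsets n

    subsetsOf-inside : ∀ (X : Subset n) →
      subsetsOf R (inside ∷ X) ≡ map (inside ∷_) (subsetsOf R X) ++ map (outside ∷_) (subsetsOf R X)
    subsetsOf-inside X = ≡.trans (filter-++ (_⊆? (inside ∷ X)) (map (inside ∷_) all) (map (outside ∷_) all))
      (≡.cong₂ _++_ (filter-⊆?-map-inside X all) (filter-⊆?-map-outside inside X all))
      where all = allSubsets n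

    ∑-subsetsOf-outside : ∀ (g : Subset (suc n) → Carrier) X →
      ∑ g (subsetsOf R (outside ∷ X)) ≡ ∑[ B ← subsetsOf R X ] g (outside ∷ B)
    ∑-subsetsOf-outside g X = ≡.trans (≡.cong (∑ g) (subsetsOf-outside X)) (∑-map g (outside ∷_) (subsetsOf R X))

    ∑-subsetsOf-inside : ∀ (g : Subset (suc n) → Carrier) X →
      ∑ g (subsetsOf R (inside ∷ X)) ≈
      ∑[ B ← subsetsOf R X ] g (inside ∷ B) + ∑[ B ← subsetsOf R X ] g (outside ∷ B)
    ∑-subsetsOf-inside g X = begin
      ∑ g (subsetsOf R (inside ∷ X))
        ≡⟨ ≡.cong (∑ g) (subsetsOf-inside X) ⟩
      ∑ g (map (inside ∷_) (subsetsOf R X) ++ map (outside ∷_) (subsetsOf R X))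
        ≈⟨ ∑-++ g (map (inside ∷_) (subsetsOf R X)) (map (outside ∷_) (subsetsOf R X)) ⟩
      ∑ g (map (inside ∷_) (subsetsOf R X)) + ∑ g (map (outside ∷_) (subsetsOf R X))
        ≡⟨ ≡.cong₂ _+_ (∑-map g (inside ∷_) (subsetsOf R X)) (∑-map g (outside ∷_) (subsetsOf R X)) ⟩
      ∑[ B ← subsetsOf R X ] g (inside ∷ B) + ∑[ B ← subsetsOf R X ] g (outside ∷ B) ∎
      where open import Relation.Binary.Reasoning.Setoid setoid

  mobius-outside : ∀ {n} (w : Subset (suc n) → Carrier) X →
    mobius R w (outside ∷ X) ≡ mobius R (w ∘ (outside ∷_)) X
  mobius-outside w X = ∑-subsetsOf-outside _ X

  mobius-inside : ∀ {n} (w : Subset (suc n) → Carrier) X →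
    mobius R w (inside ∷ X) ≈ mobius R (w ∘ (inside ∷_)) X - mobius R (w ∘ (outside ∷_)) X
  mobius-inside w X = trans (∑-subsetsOf-inside _ X) (+-congˡ (trans
    (∑-cong (λ B → sym (-‿distribˡ-* _ (w (outside ∷ B)))) (subsetsOf R X))
    (∑-neg _ (subsetsOf R X))))
    where open import Algebra.Properties.Ring ring using (-‿distribˡ-*)

  mobius-inversion : ∀ {n} (w : Subset n → Carrier) X → ∑ (mobius R w) (subsetsOf R X) ≈ w X
  mobius-inversion w [] = trans (+-identityʳ _) (trans (+-identityʳ _) (*-identityˡ (w [])))
  mobius-inversion w (outside ∷ X) = begin
    ∑ (mobius R w) (subsetsOf R (outside ∷ X))
      ≡⟨ ∑-subsetsOf-outside (mobius R w) X ⟩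
    ∑[ B ← subsetsOf R X ] mobius R w (outside ∷ B)
      ≡⟨ ≡.cong (Σl R) (map-cong (mobius-outside w) (subsetsOf R X)) ⟩
    ∑ (mobius R wₒ) (subsetsOf R X)
      ≈⟨ mobius-inversion wₒ X ⟩
    w (outside ∷ X) ∎
    where
    open import Relation.Binary.Reasoning.Setoid setoid
    wₒ = w ∘ (outside ∷_)
  mobius-inversion w (inside ∷ X) = begin
    ∑ (mobius R w) (subsetsOf R (inside ∷ X))
      ≈⟨ ∑-subsetsOf-inside (mobius R w) X ⟩
    ∑[ B ← subsetsOf R X ] mobius R w (inside ∷ B) + ∑[ B ← subsetsOf R X ] mobius R w (outside ∷ B)
      ≈⟨ +-cong (∑-cong (mobius-inside w) (subsetsOf R X))
                (reflexive (≡.cong (Σl R) (map-cong (mobius-outside w) (subsetsOf R X)))) ⟩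
    ∑[ B ← subsetsOf R X ] (mobius R wᵢ B - mobius R wₒ B) + ∑ (mobius R wₒ) (subsetsOf R X)
      ≈⟨ +-congʳ (trans (∑-+ _ _ (subsetsOf R X)) (+-congˡ (∑-neg _ (subsetsOf R X)))) ⟩
    (∑ (mobius R wᵢ) (subsetsOf R X) - ∑ (mobius R wₒ) (subsetsOf R X)) + ∑ (mobius R wₒ) (subsetsOf R X)
      ≈⟨ +-cong (+-cong (mobius-inversion wᵢ X) (-‿cong (mobius-inversion wₒ X))) (mobius-inversion wₒ X) ⟩
    (w (inside ∷ X) - wₒ X) + wₒ X  ≈⟨ +-assoc _ _ _ ⟩
    w (inside ∷ X) + (- wₒ X + wₒ X)  ≈⟨ +-congˡ (-‿inverseˡ _) ⟩
    w (inside ∷ X) + 0#  ≈⟨ +-identityʳ _ ⟩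
    w (inside ∷ X)  ∎
    where
    open import Relation.Binary.Reasoning.Setoid setoid
    wᵢ = w ∘ (inside ∷_)
    wₒ = w ∘ (outside ∷_)

  indicator : ∀ {n} → Subset n → Fin n → Carrier
  indicator T i = if does (i ∈? T) then 1# else 0#

  Πl-cong : ∀ {n} {x y : Fin n → Carrier} → (∀ i → x i ≈ y i) → ∀ is →
    Πl R (map x is) ≈ Πl R (map y is)
  Πl-cong x≈y [] = refl
  Πl-cong x≈y (i ∷ is) = *-cong (x≈y i) (Πl-cong x≈y is)

  Πl-indicator-⊆ : ∀ {n} (T : Subset n) is → All (_∈ₛ T) is → Πl R (map (indicator T) is) ≈ 1#
  Πl-indicator-⊆ T [] [] = refl
  Πl-indicator-⊆ T (i ∷ is) (i∈T ∷ is⊆T) with i ∈? T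
  ... | yes _   = trans (*-identityˡ _) (Πl-indicator-⊆ T is is⊆T)
  ... | no i∉T  = ⊥-elim (i∉T i∈T)

  Πl-indicator-⊈ : ∀ {n} (T : Subset n) is → ¬ All (_∈ₛ T) is → Πl R (map (indicator T) is) ≈ 0#
  Πl-indicator-⊈ T [] is⊈T = ⊥-elim (is⊈T [])
  Πl-indicator-⊈ T (i ∷ is) is⊈T with i ∈? T
  ... | yes i∈T = trans (*-identityˡ _) (Πl-indicator-⊈ T is (is⊈T ∘ (i∈T ∷_)))
  ... | no _    = zeroˡ _

  prodOver-indicator-* : ∀ {n} (T B : Subset n) m →
    prodOver R B (indicator T) * m ≈ (if does (B ⊆? T) then m else 0#)
  prodOver-indicator-* {n} T B m with B ⊆? T
  ... | yes B⊆T = trans (*-congʳ (Πl-indicator-⊆ T _ (All.tabulate λ i∈ → B⊆T (∈B i∈)))) (*-identityˡ m)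
    where ∈B = λ {i} i∈ → proj₂ (∈-filter⁻ (_∈? B) {v = i} {xs = allFin n} i∈)
  ... | no B⊈T = trans (*-congʳ (Πl-indicator-⊈ T _ λ B⊆T → B⊈T λ {i} i∈B →
      All.lookup B⊆T (∈-filter⁺ (_∈? B) (∈-allFin i) i∈B))) (zeroˡ m)

  Πl-updateAt-affine : ∀ {n} (x : Fin n → Carrier) j is → Unique is →
    Affine (λ a → Πl R (map (updateAt x j (const a)) is))
  Πl-updateAt-affine x j [] _ = Affine-const 1#
  Πl-updateAt-affine x j (i ∷ is) (i∉is ∷ is!) with i ≟ᶠ j
  ... | yes ≡.refl = Affine-resp (λ a → reflexive (≡.cong₂ _*_ (updateAt-updates i x)
          (≡.cong (Πl R) (map-cong-local (All.map (λ i≢k → updateAt-minimal _ i x (i≢k ∘ ≡.sym)) i∉is)))))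
        (Affine-linear (Πl R (map x is)))
  ... | no i≢j = Affine-resp (λ a → *-congʳ (reflexive (updateAt-minimal i j x i≢j)))
        (Affine-*ˡ (x i) (Πl-updateAt-affine x j is is!))

  *-zeroˡ-≈ : ∀ {x y} → x ≈ 0# → x * y ≈ 0#
  *-zeroˡ-≈ {y = y} x≈0 = trans (*-congʳ x≈0) (zeroˡ y)

  if-1-0-* : ∀ b x → (if b then 1# else 0#) * x ≈ (if b then x else 0#)
  if-1-0-* true  x = *-identityˡ x
  if-1-0-* false x = zeroˡ x

  partitionCover-column : ∀ {n p} {X : Set p} (X? : Dec X) (i : Fin n) (A : Subset n) →
    (if does X? ∧ does (i ∈? A) then 1# else 0#) ≈ indicator (if does X? then A else ⊥) i
  partitionCover-column (yes _) i A = refl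
  partitionCover-column (no _)  i A with i ∈? ⊥
  ... | yes i∈⊥ = ⊥-elim (∉⊥ i∈⊥)
  ... | no _    = refl

  module Extension {n} (w : Subset n → Carrier) where

    -- globalWorth R w q unfolds to ∑[ A ← allSubsets n ] extension A (λ i → q i A).
    extension : Subset n → (Fin n → Carrier) → Carrier
    extension A x = ∑[ B ← subsetsOf R A ] (prodOver R B x * mobius R w B)

    extension-cong : ∀ A {x y : Fin n → Carrier} → (∀ i → x i ≈ y i) → extension A x ≈ extension A y
    extension-cong A x≈y = ∑-cong (λ B → *-congʳ (Πl-cong x≈y (filter (_∈? B) (allFin n)))) (subsetsOf R A)

    extension-indicator : ∀ A T → extension A (indicator T) ≈ w (A ∩ T)
    extension-indicator A T = begin
      extension A (indicator T)
        ≈⟨ ∑-cong (λ B → prodOver-indicator-* T B (mobius R w B)) (subsetsOf R A) ⟩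
      ∑[ B ← subsetsOf R A ] (if does (B ⊆? T) then mobius R w B else 0#)
        ≈⟨ ∑-filter (_⊆? A) _ (allSubsets n) ⟩
      ∑[ B ← allSubsets n ] (if does (B ⊆? A) then (if does (B ⊆? T) then mobius R w B else 0#) else 0#)
        ≈⟨ ∑-cong ⊆-∩ (allSubsets n) ⟩
      ∑[ B ← allSubsets n ] (if does (B ⊆? (A ∩ T)) then mobius R w B else 0#)
        ≈⟨ ∑-filter (_⊆? (A ∩ T)) _ (allSubsets n) ⟨
      ∑ (mobius R w) (subsetsOf R (A ∩ T))
        ≈⟨ mobius-inversion w (A ∩ T) ⟩
      w (A ∩ T) ∎
      where
      open import Relation.Binary.Reasoning.Setoid setoid
      ⊆-∩ : ∀ B → (if does (B ⊆? A) then (if does (B ⊆? T) then mobius R w B else 0#) else 0#)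
                 ≈ (if does (B ⊆? (A ∩ T)) then mobius R w B else 0#)
      ⊆-∩ B with B ⊆? A | B ⊆? T | B ⊆? (A ∩ T)
      ... | yes _   | yes _   | yes _    = refl
      ... | yes B⊆A | yes B⊆T | no B⊈A∩T = ⊥-elim (B⊈A∩T λ i∈ → x∈p∩q⁺ (B⊆A i∈ , B⊆T i∈))
      ... | yes _   | no B⊈T  | yes B⊆A∩T = ⊥-elim (B⊈T λ i∈ → p∩q⊆q A T (B⊆A∩T i∈))
      ... | yes _   | no _    | no _     = refl
      ... | no B⊈A  | _       | yes B⊆A∩T = ⊥-elim (B⊈A λ i∈ → p∩q⊆p A T (B⊆A∩T i∈))
      ... | no _    | _       | no _     = refl

    extension-affine : ∀ A (x : Fin n → Carrier) j → Affine (λ a → extension A (updateAt x j (const a)))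
    extension-affine A x j = Affine-∑ (subsetsOf R A) λ B →
      Affine-*ʳ (mobius R w B) (Πl-updateAt-affine x j _ (Unique.filter⁺ (_∈? B) (Unique.allFin⁺ n)))

  module Worth {n} (w : Subset n → Carrier) where
    open Extension w
    open Affine

    worth : FuzzyCover R n → Carrier
    worth = globalWorth R w

    worth-cong : ∀ {q q′ : FuzzyCover R n} → (∀ i A → q i A ≈ q′ i A) → worth q ≈ worth q′
    worth-cong q≈q′ = ∑-cong (λ A → extension-cong A (λ i → q≈q′ i A)) (allSubsets n)

    worth-row-affine : ∀ (q : FuzzyCover R n) j → Σ[ b ∈ Carrier ] Σ[ d ∈ (Subset n → Carrier) ]
      ∀ r → worth (updateAt q j (const r)) ≈ b + ∑[ A ← allSubsets n ] (r A * d A)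
    worth-row-affine q j = ∑ (intercept ∘ affine) (allSubsets n) , slope ∘ affine , λ r → begin
      worth (updateAt q j (const r))
        ≈⟨ ∑-cong (λ A → extension-cong A (λ i → reflexive (column r A i))) (allSubsets n) ⟩
      ∑[ A ← allSubsets n ] extension A (updateAt (λ i → q i A) j (const (r A)))
        ≈⟨ ∑-cong (λ A → eval (affine A) (r A)) (allSubsets n) ⟩
      ∑[ A ← allSubsets n ] (intercept (affine A) + r A * slope (affine A))
        ≈⟨ ∑-+ _ _ (allSubsets n) ⟩
      ∑ (intercept ∘ affine) (allSubsets n) + ∑[ A ← allSubsets n ] (r A * slope (affine A)) ∎
      where
      open import Relation.Binary.Reasoning.Setoid setoid
      column : ∀ (r : Subset n → Carrier) A i → updateAt q j (const r) i A ≡ updateAt (λ i → q i A) j (const (r A)) i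
      column r A = map-updateAt {f = _$ A} {g = const r} (λ _ → ≡.refl) q j
      affine : ∀ A → Affine (λ a → extension A (updateAt (λ i → q i A) j (const a)))
      affine A = extension-affine A (λ i → q i A) j

    subsetsContaining : Fin n → List (Subset n)
    subsetsContaining j = filter (j ∈?_) (allSubsets n)

    IsFuzzyRow : Fin n → (Subset n → Carrier) → Set (ℓ₁ ⊔ ℓ₂)
    IsFuzzyRow j r = (∀ A → 0# ≤ r A) × (∀ A → j ∉ₛ A → r A ≈ 0#) × ∑ r (subsetsContaining j) ≈ 1#

    fuzzyCover⇒row : ∀ {q : FuzzyCover R n} → IsFuzzyCover R q → ∀ j → IsFuzzyRow j (q j)
    fuzzyCover⇒row (q≥0 , q≈0 , ∑q≈1) j = q≥0 j , q≈0 j , ∑q≈1 j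

    rows⇒fuzzyCover : ∀ {q : FuzzyCover R n} → (∀ j → IsFuzzyRow j (q j)) → IsFuzzyCover R q
    rows⇒fuzzyCover rows = proj₁ ∘ rows , proj₁ ∘ proj₂ ∘ rows , proj₂ ∘ proj₂ ∘ rows

    pointMass : Subset n → Subset n → Carrier
    pointMass S A = if does (A ≟ₛ S) then 1# else 0#

    pointMass-fuzzyRow : ∀ {j S} → j ∈ₛ S → IsFuzzyRow j (pointMass S)
    pointMass-fuzzyRow {j} {S} j∈S = nonneg , vanish ,
      ∑-indicator _≟ₛ_ (const 1#) (subsetsContaining j) (Unique.filter⁺ (j ∈?_) (allSubsets-unique n))
        (∈-filter⁺ (j ∈?_) (∈-allSubsets S) j∈S)
      where
      nonneg : ∀ A → 0# ≤ pointMass S A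
      nonneg A with A ≟ₛ S
      ... | yes _ = 0≤1
      ... | no _  = ≤-refl
      vanish : ∀ A → j ∉ₛ A → pointMass S A ≈ 0#
      vanish A j∉A with A ≟ₛ S
      ... | yes ≡.refl = ⊥-elim (j∉A j∈S)
      ... | no _       = refl

    ∑-pointMass-* : ∀ S (d : Subset n → Carrier) → ∑[ A ← allSubsets n ] (pointMass S A * d A) ≈ d S
    ∑-pointMass-* S d = trans (∑-cong (λ A → if-1-0-* (does (A ≟ₛ S)) (d A)) (allSubsets n))
      (∑-indicator _≟ₛ_ d (allSubsets n) (allSubsets-unique n) (∈-allSubsets S))

    improve-row : ∀ {q : FuzzyCover R n} → IsFuzzyCover R q → ∀ j →
      Σ[ S ∈ Subset n ] j ∈ₛ S × worth q ≤ worth (updateAt q j (const (pointMass S)))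
    improve-row {q} q-fuzzy j with worth-row-affine q j | fuzzyCover⇒row q-fuzzy j
    ... | b , d , eval | q≥0 , q≈0 , ∑q≈1 = S , j∈S , (begin
      worth q
        ≈⟨ worth-cong (λ i A → reflexive (≡.cong (_$ A) (updateAt-id-local j q ≡.refl i))) ⟨
      worth (updateAt q j (const (q j)))
        ≈⟨ eval (q j) ⟩
      b + ∑[ A ← allSubsets n ] (q j A * d A)
        ≈⟨ +-congˡ (∑-filter-support (j ∈?_) (allSubsets n) λ A j∉A → *-zeroˡ-≈ (q≈0 A j∉A)) ⟨
      b + ∑[ A ← subsetsContaining j ] (q j A * d A)
        ≤⟨ +-mono₂-≤ ≤-refl (∑-convex-≤ (subsetsContaining j) (λ {A} _ → q≥0 A) ∑q≈1 d≤d[S]) ⟩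
      b + d S
        ≈⟨ +-congˡ (∑-pointMass-* S d) ⟨
      b + ∑[ A ← allSubsets n ] (pointMass S A * d A)
        ≈⟨ eval (pointMass S) ⟨
      worth (updateAt q j (const (pointMass S))) ∎)
      where
      open ≤-Reasoning
      open Extrema totalOrder using (argmax; argmax-all; f[xs]≤f[argmax])
      S = argmax d ⊤ (subsetsContaining j)
      j∈S : j ∈ₛ S
      j∈S = argmax-all d ∈⊤ (All.tabulate λ A∈ → proj₂ (∈-filter⁻ (j ∈?_) {xs = allSubsets n} A∈))
      d≤d[S] : ∀ {A} → A ∈ subsetsContaining j → d A ≤ d S
      d≤d[S] = All.lookup (f[xs]≤f[argmax] ⊤ (subsetsContaining j))

    IsVertexRow : FuzzyCover R n → Fin n → Set c
    IsVertexRow q i = Σ[ S ∈ Subset n ] i ∈ₛ S × q i ≡ pointMass S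

    updateAt-pointMass-fuzzy : ∀ {q : FuzzyCover R n} {j S} → IsFuzzyCover R q → j ∈ₛ S →
      IsFuzzyCover R (updateAt q j (const (pointMass S)))
    updateAt-pointMass-fuzzy {q} {j} {S} q-fuzzy j∈S = rows⇒fuzzyCover row
      where
      row : ∀ i → IsFuzzyRow i (updateAt q j (const (pointMass S)) i)
      row i with i ≟ᶠ j
      ... | yes ≡.refl = ≡.subst (IsFuzzyRow i) (≡.sym (updateAt-updates i q)) (pointMass-fuzzyRow j∈S)
      ... | no i≢j     = ≡.subst (IsFuzzyRow i) (≡.sym (updateAt-minimal i j q i≢j)) (fuzzyCover⇒row q-fuzzy i)

    updateAt-pointMass-vertexRow : ∀ {q : FuzzyCover R n} {j S js} → j ∈ₛ S →
      (∀ {i} → i ∈ js → IsVertexRow q i) →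
      ∀ {i} → i ∈ j ∷ js → IsVertexRow (updateAt q j (const (pointMass S))) i
    updateAt-pointMass-vertexRow {q} {j} {S} j∈S js-vertex {i} i∈ with i ≟ᶠ j | i∈
    ... | yes ≡.refl | _          = S , j∈S , updateAt-updates i q
    ... | no i≢j     | here i≡j   = ⊥-elim (i≢j i≡j)
    ... | no i≢j     | there i∈js =
      let T , i∈T , q[i]≡T = js-vertex i∈js in T , i∈T , ≡.trans (updateAt-minimal i j q i≢j) q[i]≡T

    round-rows : ∀ (js : List (Fin n)) {q : FuzzyCover R n} → IsFuzzyCover R q →
      Σ[ q′ ∈ FuzzyCover R n ] IsFuzzyCover R q′ × worth q ≤ worth q′ ×
        (∀ {i} → i ∈ js → IsVertexRow q′ i)
    round-rows [] {q} q-fuzzy = q , q-fuzzy , ≤-refl , λ ()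
    round-rows (j ∷ js) q-fuzzy =
      let q′ , q′-fuzzy , q≤q′ , q′-vertex = round-rows js q-fuzzy
          S , j∈S , q′≤q″ = improve-row q′-fuzzy j
      in  updateAt q′ j (const (pointMass S)) , updateAt-pointMass-fuzzy q′-fuzzy j∈S ,
          ≤-trans q≤q′ q′≤q″ , updateAt-pointMass-vertexRow j∈S q′-vertex

    vertex : (Fin n → Subset n) → FuzzyCover R n
    vertex ch i = pointMass (ch i)

    round-to-vertex : ∀ {q : FuzzyCover R n} → IsFuzzyCover R q →
      Σ[ ch ∈ (Fin n → Subset n) ] IsChoice ch × worth q ≤ worth (vertex ch)
    round-to-vertex q-fuzzy =
      let q′ , _ , q≤q′ , q′-vertex = round-rows (allFin n) q-fuzzy
          vertexRow : ∀ i → IsVertexRow q′ i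
          vertexRow i = q′-vertex (∈-allFin i)
      in  proj₁ ∘ vertexRow , proj₁ ∘ proj₂ ∘ vertexRow ,
          ≤-trans q≤q′ (≤-reflexive (worth-cong λ i A →
            reflexive (≡.cong (_$ A) (proj₂ (proj₂ (vertexRow i))))))


    indicator-fibre : ∀ ch A i → indicator (fibre ch A) i ≡ pointMass (ch i) A
    indicator-fibre ch A i with i ∈? fibre ch A | A ≟ₛ ch i
    ... | yes _   | yes _      = ≡.refl
    ... | no _    | no _       = ≡.refl
    ... | yes i∈  | no A≢ch[i] = ⊥-elim (A≢ch[i] (∈-fibre⁻ ch i∈))
    ... | no i∉   | yes ≡.refl = ⊥-elim (i∉ (∈-fibre⁺ ch i))

    worth-vertex : ∀ ch → worth (vertex ch) ≈ ∑[ A ← allSubsets n ] w (block ch A)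
    worth-vertex ch = ∑-cong (λ A → trans
      (extension-cong A (λ i → reflexive (≡.sym (indicator-fibre ch A i))))
      (extension-indicator A (fibre ch A))) (allSubsets n)

    validChoices : List (Fin n → Subset n)
    validChoices = filter isChoice? (allFunctions (allSubsets n) n)

    best : Fin n → Subset n
    best = argmax (worth ∘ vertex) (const ⊤) validChoices
      where open Extrema totalOrder using (argmax)

    best-isChoice : IsChoice best
    best-isChoice = argmax-all (worth ∘ vertex) (λ _ → ∈⊤) (all-filter isChoice? (allFunctions (allSubsets n) n))
      where open Extrema totalOrder using (argmax-all)

    vertex-≤-best : ∀ {ch} → IsChoice ch → worth (vertex ch) ≤ worth (vertex best)
    vertex-≤-best {ch} i∈ch[i] with allFunctions-complete (allSubsets n) n ch (λ i → ∈-allSubsets (ch i))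
    ... | g , g∈ , g≗ch = ≤-trans
      (≤-reflexive (worth-cong λ i A → reflexive (≡.cong (λ S → pointMass S A) (≡.sym (g≗ch i)))))
      (All.lookup (f[xs]≤f[argmax] (const ⊤) validChoices)
        (∈-filter⁺ isChoice? g∈ λ i → ≡.subst (i ∈ₛ_) (≡.sym (g≗ch i)) (i∈ch[i] i)))
      where open Extrema totalOrder using (f[xs]≤f[argmax])

    sumOverBlocks-blocks : w ⊥ ≈ 0# → ∀ ch →
      sumOverBlocks R w (blocks ch) ≈ ∑[ A ← allSubsets n ] w (block ch A)
    sumOverBlocks-blocks w[∅]≈0 ch = trans
      (∑-filter-support nonempty? (map (block ch) (allSubsets n))
        (λ X X=∅ → trans (reflexive (≡.cong w (Empty-unique X=∅))) w[∅]≈0))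
      (reflexive (∑-map w (block ch) (allSubsets n)))

    worth-partitionCover : w ⊥ ≈ 0# → ∀ {P} → Unique P → worth (partitionCover R P) ≈ sumOverBlocks R w P
    worth-partitionCover w[∅]≈0 {P} P! = trans (∑-cong column (allSubsets n))
      (∑-indicator-list _≟ₛ_ w P (allSubsets-unique n) P! (λ {A} _ → ∈-allSubsets A))
      where
      open import Relation.Binary.Reasoning.Setoid setoid
      w-∩-select : ∀ {p} {X : Set p} (X? : Dec X) A →
        w (A ∩ (if does X? then A else ⊥)) ≈ (if does X? then w A else 0#)
      w-∩-select (yes _) A = reflexive (≡.cong w (∩-idem A))
      w-∩-select (no _)  A = trans (reflexive (≡.cong w (∩-zeroʳ A))) w[∅]≈0
      column : ∀ A → extension A (λ i → partitionCover R P i A) ≈ (if does (any? (A ≟ₛ_) P) then w A else 0#)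
      column A = begin
        extension A (λ i → partitionCover R P i A)
          ≈⟨ extension-cong A (λ i → partitionCover-column (any? (A ≟ₛ_) P) i A) ⟩
        extension A (indicator (if does (any? (A ≟ₛ_) P) then A else ⊥))
          ≈⟨ extension-indicator A (if does (any? (A ≟ₛ_) P) then A else ⊥) ⟩
        w (A ∩ (if does (any? (A ≟ₛ_) P) then A else ⊥))
          ≈⟨ w-∩-select (any? (A ≟ₛ_) P) A ⟩
        (if does (any? (A ≟ₛ_) P) then w A else 0#) ∎

corollary8 : ∀ {c ℓ₁ ℓ₂ : Level} (R : OrderedCommRing c ℓ₁ ℓ₂) (n : ℕ)
    (w : Subset n → OrderedCommRing.Carrier R) →
    OrderedCommRing._≈_ R (w ⊥) (OrderedCommRing.0# R) →
    Σ (List (Subset n)) λ P →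
    IsPartition P ×
    (∀ (q : FuzzyCover R n) → IsFuzzyCover R q →
    OrderedCommRing._≤_ R (globalWorth R w q) (globalWorth R w (partitionCover R P))) ×
    OrderedCommRing._≈_ R (globalWorth R w (partitionCover R P)) (sumOverBlocks R w P)
corollary8 R n w w[∅]≈0 = blocks best , partition , optimal , worth-partitionCover w[∅]≈0 P!
  where
  open OrderedCommRing R
  open Worth R w
  open ≤-Reasoning R
  partition = blocks-partition best-isChoice
  P! = disjoint-nonempty⇒unique (proj₁ partition) (proj₁ (proj₂ partition))
  optimal : ∀ q → IsFuzzyCover R q → worth q ≤ worth (partitionCover R (blocks best))
  optimal q q-fuzzy = let ch , i∈ch[i] , q≤vertex = round-to-vertex q-fuzzy in begin
    worth q                                 ≤⟨ q≤vertex ⟩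
    worth (vertex ch)                       ≤⟨ vertex-≤-best i∈ch[i] ⟩
    worth (vertex best)                     ≈⟨ worth-vertex best ⟩
    ∑ R (w ∘ block best) (allSubsets n)     ≈⟨ sumOverBlocks-blocks w[∅]≈0 best ⟨
    sumOverBlocks R w (blocks best)         ≈⟨ worth-partitionCover w[∅]≈0 P! ⟨
    worth (partitionCover R (blocks best))  ∎
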